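{- Let $G=(V,E)$ be a directed graph with non-negative arc weights $w:E\to\mathbb Q_{\ge0}$, let $s_1,s_2\in V$ with $s_1\neq s_2$, and let $\alpha_1,\alpha_2\in\mathbb Q_{\ge0}$. There exists a pair of compatible paths for $s_1,s_2$ (with bounds $\alpha_1,\alpha_2$) in $G$ if and only if there exists a vertex $t\in V$ with $d(s_1,t)\le\alpha_1$ and $d(s_2,t)\le\alpha_2$.
   Context: A path is a directed simple path. A path may consist of a single vertex and no arcs, in which case its weight is $0$. The weight $w(p)$ of a path is the sum of its arc weights. $d(x,y)$ is the minimum weight of a path from $x$ to $y$ in $G$, and equals $+\infty$ if there is none. A pair of compatible paths for $s_1,s_2$ with bounds $\alpha_1,\alpha_2$ is a pair of paths $p_1$ from $s_1$ to $t$ and $p_2$ from $s_2$ to the same vertex $t$ such that $w(p_1)\le\alpha_1$, $w(p_2)\le\alpha_2$, and $p_1,p_2$ are internally vertex-disjoint. -}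

module Defs where

open import Data.Nat using (ℕ)
open import Data.Fin using (Fin)
open import Data.List using (List; []; _∷_)
open import Data.List.Membership.Propositional using (_∈_)
open import Data.List.Relation.Unary.Unique.Propositional using (Unique)
open import Data.Rational using (ℚ; 0ℚ; _+_; _≤_)
open import Data.Product using (Σ; _×_; ∃-syntax; _,_; proj₁)
open import Data.Sum using (_⊎_)
open import Relation.Binary.PropositionalEquality using (_≡_)

record Digraph : Set where
  field
    nV    : ℕ
    nA    : ℕ
    tail  : Fin nA → Fin nV
    head  : Fin nA → Fin nV
    weight : Fin nA → ℚ

module _ (G : Digraph) where
  open Digraph G

  Vertex : Set
  Vertex = Fin nV

  data Walk : Vertex → Vertex → Set where
    []  : ∀ {x} → Walk x x
    _∷_ : ∀ {y} (e : Fin nA) → Walk (head e) y → Walk (tail e) y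

  verts : ∀ {x y} → Walk x y → List Vertex
  verts {x} []      = x ∷ []
  verts {x} (e ∷ p) = x ∷ verts p

  w : ∀ {x y} → Walk x y → ℚ
  w []      = 0ℚ
  w (e ∷ p) = weight e + w p

  Path : Vertex → Vertex → Set
  Path x y = Σ (Walk x y) λ p → Unique (verts p)

  wP : ∀ {x y} → Path x y → ℚ
  wP (p , _) = w p

  IsDist : Vertex → Vertex → ℚ → Set
  IsDist x y δ = (∃[ p ] wP {x} {y} p ≡ δ) × (∀ (q : Path x y) → δ ≤ wP q)

  -- d(x,y) ≤ α, where d(x,y) = +∞ if there is no path (then this fails).
  DistLe : Vertex → Vertex → ℚ → Set
  DistLe x y α = ∃[ δ ] (IsDist x y δ × δ ≤ α)

  InternallyDisjoint : ∀ {s₁ s₂ t} → Path s₁ t → Path s₂ t → Set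
  InternallyDisjoint {s₁} {s₂} {t} p₁ p₂ =
    (∀ v → v ∈ verts (proj₁ p₁) → v ∈ verts (proj₁ p₂) → v ≡ s₁ ⊎ v ≡ t) ×
    (∀ v → v ∈ verts (proj₁ p₂) → v ∈ verts (proj₁ p₁) → v ≡ s₂ ⊎ v ≡ t)

  CompatiblePaths : Vertex → Vertex → ℚ → ℚ → Set
  CompatiblePaths s₁ s₂ α₁ α₂ =
    ∃[ t ] Σ (Path s₁ t) λ p₁ → Σ (Path s₂ t) λ p₂ →
      (wP p₁ ≤ α₁) × (wP p₂ ≤ α₂) × InternallyDisjoint p₁ p₂

-- A shortest path to a common endpoint t exists as soon as some path does, which gives
-- the forward direction. Conversely, take paths p₁ : s₁ → t and p₂ : s₂ → t within the
-- bounds and let z be the first vertex of p₁ lying on p₂. The prefixes of p₁ and p₂ ending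
-- at z are paths, they are no heavier than p₁ and p₂ since weights are non-negative, and
-- they meet only at z: a vertex common to both lies on p₁ before z and on p₂.
module Submission where

open import Defs
open import Data.Fin using (Fin)
open import Data.Rational using (ℚ; 0ℚ; _≤_)
open import Data.Product using (_×_; ∃-syntax)
open import Function.Bundles using (_⇔_)
open import Relation.Binary.PropositionalEquality using (_≢_)

open import Data.Empty using (⊥-elim)
open import Data.Fin using (zero; suc) renaming (_≟_ to _≟ᶠ_)
open import Data.Fin.Properties using (injective⇒≤)
open import Data.List using (List; []; _∷_; _++_; map; concatMap; filter; length; lookup; allFin)
open import Data.List.Membership.Propositional using (_∈_; lose)
open import Data.List.Membership.Propositional.Properties
  using (∈-lookup; ∈-map⁺; ∈-++⁺ˡ; ∈-++⁺ʳ; ∈-concatMap⁺; ∈-filter⁺; ∈-allFin)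
open import Data.List.Relation.Binary.Subset.Propositional using (_⊆_)
open import Data.List.Relation.Unary.All as All using (All)
open import Data.List.Relation.Unary.All.Properties using (all-filter; anti-mono)
open import Data.List.Relation.Unary.Any using (Any; here; there)
open import Data.List.Relation.Unary.AllPairs using ([]; _∷_)
open import Data.List.Relation.Unary.Unique.Propositional using (Unique)
open import Data.Nat as ℕ using (ℕ; zero; suc; s≤s)
open import Data.Nat.Properties using (<⇒≤)
open import Data.Product using (Σ; _,_; proj₁; proj₂)
open import Data.Rational using (_+_)
open import Data.Rational.Properties as ℚ using (≤-decTotalOrder)
open import Data.Sum using (inj₂)
open import Function using (_∘_)
open import Function.Bundles using (mk⇔)
open import Level using (0ℓ)
open import Relation.Binary.Bundles using (DecTotalOrder)
open import Relation.Binary.PropositionalEquality using (_≡_; refl; sym; cong; subst)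
open import Relation.Nullary using (yes; no)
open import Relation.Unary using (Pred; Decidable)

import Data.List.Extrema (DecTotalOrder.totalOrder ≤-decTotalOrder) as Extrema

Unique⇒lookup-injective : ∀ {A : Set} {xs : List A} → Unique xs →
  ∀ i j → lookup xs i ≡ lookup xs j → i ≡ j
Unique⇒lookup-injective (_  ∷ _) zero    zero    _  = refl
Unique⇒lookup-injective (x∉ ∷ _) zero    (suc j) eq = ⊥-elim (All.lookup x∉ (∈-lookup j) eq)
Unique⇒lookup-injective (x∉ ∷ _) (suc i) zero    eq = ⊥-elim (All.lookup x∉ (∈-lookup i) (sym eq))
Unique⇒lookup-injective (_  ∷ u) (suc i) (suc j) eq = cong suc (Unique⇒lookup-injective u i j eq)

Unique⇒length≤ : ∀ {n} {xs : List (Fin n)} → Unique xs → length xs ℕ.≤ n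
Unique⇒length≤ u = injective⇒≤ (Unique⇒lookup-injective u _ _)

module _ (G : Digraph) where
  open Digraph G
  open import Data.List.Membership.DecPropositional (_≟ᶠ_ {nV}) using (_∈?_)
  open import Data.List.Relation.Unary.Unique.DecPropositional (_≟ᶠ_ {nV}) using (unique?)

  walkLength : ∀ {x y} → Walk G x y → ℕ
  walkLength []      = 0
  walkLength (_ ∷ p) = suc (walkLength p)

  length-verts : ∀ {x y} (p : Walk G x y) → length (verts G p) ≡ suc (walkLength p)
  length-verts []      = refl
  length-verts (_ ∷ p) = cong suc (length-verts p)

  walkLength-path : ∀ {x y} (p : Path G x y) → walkLength (proj₁ p) ℕ.≤ nV
  walkLength-path (p , u) = <⇒≤ (subst (ℕ._≤ nV) (length-verts p) (Unique⇒length≤ u))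

  ∈-verts-end : ∀ {x y} (p : Walk G x y) → y ∈ verts G p
  ∈-verts-end []      = here refl
  ∈-verts-end (_ ∷ p) = there (∈-verts-end p)

  trivialWalks : (x y : Vertex G) → List (Walk G x y)
  trivialWalks x y with x ≟ᶠ y
  ... | yes refl = [] ∷ []
  ... | no _     = []

  prependArc : ∀ {x y} (e : Fin nA) → List (Walk G (head e) y) → List (Walk G x y)
  prependArc {x} e ps with tail e ≟ᶠ x
  ... | yes refl = map (e ∷_) ps
  ... | no _     = []

  walksUpTo : ℕ → (x y : Vertex G) → List (Walk G x y)
  walksUpTo zero    x y = trivialWalks x y
  walksUpTo (suc k) x y =
    trivialWalks x y ++ concatMap (λ e → prependArc e (walksUpTo k (head e) y)) (allFin nA)

  []∈trivialWalks : ∀ x → [] ∈ trivialWalks x x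
  []∈trivialWalks x with x ≟ᶠ x
  ... | yes refl = here refl
  ... | no x≢x   = ⊥-elim (x≢x refl)

  ∈-prependArc : ∀ {y} e {p : Walk G (head e) y} {ps} → p ∈ ps → (e ∷ p) ∈ prependArc e ps
  ∈-prependArc e p∈ps with tail e ≟ᶠ tail e
  ... | yes refl = ∈-map⁺ (e ∷_) p∈ps
  ... | no e≢e   = ⊥-elim (e≢e refl)

  walksUpTo-complete : ∀ k {x y} (p : Walk G x y) → walkLength p ℕ.≤ k → p ∈ walksUpTo k x y
  walksUpTo-complete zero    {x} []      _ = []∈trivialWalks x
  walksUpTo-complete (suc k) {x} []      _ = ∈-++⁺ˡ ([]∈trivialWalks x)
  walksUpTo-complete (suc k) {y = y} (e ∷ p) (s≤s p≤k) =
    ∈-++⁺ʳ (trivialWalks (tail e) y)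
      (∈-concatMap⁺ (λ e′ → prependArc e′ (walksUpTo k (head e′) y))
        (lose (∈-allFin e) (∈-prependArc e (walksUpTo-complete k p p≤k))))

  pathCandidates : (x y : Vertex G) → List (Walk G x y)
  pathCandidates x y = filter (unique? ∘ verts G) (walksUpTo nV x y)

  ∈-pathCandidates : ∀ {x y} (p : Path G x y) → proj₁ p ∈ pathCandidates x y
  ∈-pathCandidates p@(q , u) =
    ∈-filter⁺ (unique? ∘ verts G) (walksUpTo-complete nV q (walkLength-path p)) u

  path⇒IsDist : ∀ {x y} → Path G x y → ∃[ δ ] IsDist G x y δ
  path⇒IsDist {x} {y} (p , u) =
    w G shortest , ((shortest , shortest-unique) , refl) , shortest-minimal
    where
    shortest : Walk G x y
    shortest = Extrema.argmin (w G) p (pathCandidates x y)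

    shortest-unique : Unique (verts G shortest)
    shortest-unique =
      Extrema.argmin-all (w G) u (all-filter (unique? ∘ verts G) (walksUpTo nV x y))

    shortest-minimal : ∀ q → w G shortest ≤ wP G q
    shortest-minimal q =
      All.lookup (Extrema.f[argmin]≤f[xs] p (pathCandidates x y)) (∈-pathCandidates q)

  path⇒DistLe : ∀ {x y α} (p : Path G x y) → wP G p ≤ α → DistLe G x y α
  path⇒DistLe p p≤α with path⇒IsDist p
  ... | δ , isDist@(_ , δ-minimal) = δ , isDist , ℚ.≤-trans (δ-minimal p) p≤α

  DistLe⇒path : ∀ {x y α} → DistLe G x y α → Σ (Path G x y) λ p → wP G p ≤ α
  DistLe⇒path (_ , ((p , refl) , _) , δ≤α) = p , δ≤α

  infix 4 _⊑_
  data _⊑_ : ∀ {x z y} → Walk G x z → Walk G x y → Set where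
    []⊑ : ∀ {x y} {p : Walk G x y} → [] ⊑ p
    ∷⊑  : ∀ {z y} e {a : Walk G (head e) z} {p : Walk G (head e) y} → a ⊑ p → e ∷ a ⊑ e ∷ p

  ⊑-verts : ∀ {x z y} {a : Walk G x z} {p : Walk G x y} → a ⊑ p → verts G a ⊆ verts G p
  ⊑-verts {p = []}    []⊑ (here refl) = here refl
  ⊑-verts {p = _ ∷ _} []⊑ (here refl) = here refl
  ⊑-verts (∷⊑ _ a⊑p) (here refl) = here refl
  ⊑-verts (∷⊑ _ a⊑p) (there v∈a) = there (⊑-verts a⊑p v∈a)

  ⊑-unique : ∀ {x z y} {a : Walk G x z} {p : Walk G x y} →
    a ⊑ p → Unique (verts G p) → Unique (verts G a)
  ⊑-unique []⊑          _          = All.[] ∷ []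
  ⊑-unique (∷⊑ _ a⊑p) (x∉p ∷ u) = anti-mono (⊑-verts a⊑p) x∉p ∷ ⊑-unique a⊑p u

  ∈⇒prefix : ∀ {x y v} {p : Walk G x y} → v ∈ verts G p → Σ (Walk G x v) (_⊑ p)
  ∈⇒prefix {p = []}    (here refl) = [] , []⊑
  ∈⇒prefix {p = _ ∷ _} (here refl) = [] , []⊑
  ∈⇒prefix {p = e ∷ _} (there v∈p) with ∈⇒prefix v∈p
  ... | a , a⊑p = e ∷ a , ∷⊑ e a⊑p

  record FirstVisit (Q : Pred (Vertex G) 0ℓ) {x y} (p : Walk G x y) : Set where
    field
      end      : Vertex G
      prefix   : Walk G x end
      isPrefix : prefix ⊑ p
      visits   : Q end
      first    : ∀ {v} → v ∈ verts G prefix → Q v → v ≡ end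

  firstVisit : ∀ {Q x y} → Decidable Q → (p : Walk G x y) → Any Q (verts G p) → FirstVisit Q p
  firstVisit {x = x} Q? p Qp with Q? x
  ... | yes Qx = record
    { end = x ; prefix = [] ; isPrefix = []⊑ ; visits = Qx ; first = λ { (here refl) _ → refl } }
  firstVisit Q? []      (here Qx)  | no ¬Qx = ⊥-elim (¬Qx Qx)
  firstVisit Q? (e ∷ p) (here Qx)  | no ¬Qx = ⊥-elim (¬Qx Qx)
  firstVisit Q? (e ∷ p) (there Qp) | no ¬Qx = record
    { end = end ; prefix = e ∷ prefix ; isPrefix = ∷⊑ e isPrefix ; visits = visits
    ; first = λ { (here refl) Qv → ⊥-elim (¬Qx Qv) ; (there v∈) Qv → first v∈ Qv } }
    where open FirstVisit (firstVisit Q? p Qp)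

  module _ (weight-nonneg : ∀ e → 0ℚ ≤ weight e) where

    w-nonneg : ∀ {x y} (p : Walk G x y) → 0ℚ ≤ w G p
    w-nonneg []      = ℚ.≤-refl
    w-nonneg (e ∷ p) = subst (_≤ weight e + w G p) (ℚ.+-identityˡ 0ℚ)
                         (ℚ.+-mono-≤ (weight-nonneg e) (w-nonneg p))

    ⊑-w≤ : ∀ {x z y} {a : Walk G x z} {p : Walk G x y} → a ⊑ p → w G a ≤ w G p
    ⊑-w≤ {p = p} []⊑ = w-nonneg p
    ⊑-w≤ (∷⊑ e a⊑p) = ℚ.+-monoʳ-≤ (weight e) (⊑-w≤ a⊑p)

    paths⇒CompatiblePaths : ∀ {s₁ s₂ t α₁ α₂} (p₁ : Path G s₁ t) (p₂ : Path G s₂ t) →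
      wP G p₁ ≤ α₁ → wP G p₂ ≤ α₂ → CompatiblePaths G s₁ s₂ α₁ α₂
    paths⇒CompatiblePaths (p₁ , u₁) (p₂ , u₂) p₁≤α₁ p₂≤α₂ =
      end , (prefix , ⊑-unique isPrefix u₁) , (a₂ , ⊑-unique a₂⊑p₂ u₂) ,
      ℚ.≤-trans (⊑-w≤ isPrefix) p₁≤α₁ , ℚ.≤-trans (⊑-w≤ a₂⊑p₂) p₂≤α₂ ,
      (λ v v∈a₁ v∈a₂ → inj₂ (meetOnlyAtEnd v∈a₁ v∈a₂)) ,
      (λ v v∈a₂ v∈a₁ → inj₂ (meetOnlyAtEnd v∈a₁ v∈a₂))
      where
      open FirstVisit (firstVisit (_∈? verts G p₂) p₁ (lose (∈-verts-end p₁) (∈-verts-end p₂)))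

      a₂ : Walk G _ end
      a₂ = proj₁ (∈⇒prefix visits)

      a₂⊑p₂ : a₂ ⊑ p₂
      a₂⊑p₂ = proj₂ (∈⇒prefix visits)

      meetOnlyAtEnd : ∀ {v} → v ∈ verts G prefix → v ∈ verts G a₂ → v ≡ end
      meetOnlyAtEnd v∈a₁ v∈a₂ = first v∈a₁ (⊑-verts a₂⊑p₂ v∈a₂)

mainTheorem8 : (G : Digraph) →
    (∀ (e : Fin (Digraph.nA G)) → 0ℚ ≤ Digraph.weight G e) →
    (s₁ s₂ : Vertex G) → s₁ ≢ s₂ →
    (α₁ α₂ : ℚ) → 0ℚ ≤ α₁ → 0ℚ ≤ α₂ →
    CompatiblePaths G s₁ s₂ α₁ α₂ ⇔ (∃[ t ] (DistLe G s₁ t α₁ × DistLe G s₂ t α₂))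
mainTheorem8 G weight-nonneg s₁ s₂ _ α₁ α₂ _ _ = mk⇔ to from
  where
  to : CompatiblePaths G s₁ s₂ α₁ α₂ → ∃[ t ] (DistLe G s₁ t α₁ × DistLe G s₂ t α₂)
  to (t , p₁ , p₂ , p₁≤α₁ , p₂≤α₂ , _) = t , path⇒DistLe G p₁ p₁≤α₁ , path⇒DistLe G p₂ p₂≤α₂

  from : ∃[ t ] (DistLe G s₁ t α₁ × DistLe G s₂ t α₂) → CompatiblePaths G s₁ s₂ α₁ α₂
  from (t , d₁ , d₂) with DistLe⇒path G d₁ | DistLe⇒path G d₂
  ... | p₁ , p₁≤α₁ | p₂ , p₂≤α₂ = paths⇒CompatiblePaths G weight-nonneg p₁ p₂ p₁≤α₁ p₂≤α₂
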